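{- Let $R$ be a relation over the nodes of a $\lambda$-graph $G$ and $n,m$ nodes of $G$. Then $n\,R^{\Downarrow}\,m$ if and only if there exist a trace $\tau$ and nodes $n',m'$ such that $n'Rm'$, $n'\xrightarrow{\tau}n$ and $m'\xrightarrow{\tau}m$.
   Context: A $\lambda$-graph is a finite directed graph with application nodes $\mathrm{App}(n_1,n_2)$ (left child $n_1$, direction $\swarrow$; right child $n_2$, direction $\searrow$), abstraction nodes $\mathrm{Abs}(n)$ (child $n$, direction $\downarrow$), free variable nodes and bound variable nodes (binding edge to an abstraction node), acyclic when binding edges are ignored, with each bound variable node dominated by its binder. Paths: $n\xrightarrow{\epsilon}n$; if $n\xrightarrow{\tau}\mathrm{Abs}(m)$ then $n\xrightarrow{\downarrow\cdot\tau}m$; if $n\xrightarrow{\tau}\mathrm{App}(m_1,m_2)$ then $n\xrightarrow{\swarrow\cdot\tau}m_1$, $n\xrightarrow{\searrow\cdot\tau}m_2$ (traces are finite sequences of directions, $d\cdot\tau$ being $\tau$ followed by $d$). The propagation $R^{\Downarrow}$ of $R$ is the smallest relation containing $R$ such that $\mathrm{App}(n_1,n_2)\,R^{\Downarrow}\,\mathrm{App}(m_1,m_2)$ implies $n_1R^{\Downarrow}m_1$ and $n_2R^{\Downarrow}m_2$, and $\mathrm{Abs}(n)\,R^{\Downarrow}\,\mathrm{Abs}(m)$ implies $nR^{\Downarrow}m$. -}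

module Defs where

open import Data.Nat using (ℕ)
open import Data.Fin using (Fin)
open import Data.List using (List; []; _∷_; _∷ʳ_; _++_)
open import Data.Product using (Σ; _×_; _,_)
open import Relation.Binary.PropositionalEquality using (_≡_)
open import Relation.Nullary using (¬_)
open import Relation.Binary.Core using (Rel)
open import Level using (0ℓ)

data Label (N : ℕ) : Set where
  App  : Fin N → Fin N → Label N   -- left child, right child
  Abs  : Fin N → Label N
  FVar : Label N
  BVar : Fin N → Label N           -- bound variable, binding edge to its binder

-- Directions: ↙ (left of App), ↘ (right of App), ↓ (body of Abs)
data Dir : Set where
  ↙ ↘ ↓ : Dir

-- Traces: finite sequences of directions.  d · τ  is  τ ∷ʳ d  (τ followed by d).
Trace : Set
Trace = List Dir

-- Paths (binding edges are not followed), following the paper's inductive definition.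
data Path {N : ℕ} (lab : Fin N → Label N) : Fin N → Trace → Fin N → Set where
  ε   : ∀ {n} → Path lab n [] n
  dn  : ∀ {n τ k m} → Path lab n τ k → lab k ≡ Abs m → Path lab n (τ ∷ʳ ↓) m
  lft : ∀ {n τ k m₁ m₂} → Path lab n τ k → lab k ≡ App m₁ m₂ → Path lab n (τ ∷ʳ ↙) m₁
  rgt : ∀ {n τ k m₁ m₂} → Path lab n τ k → lab k ≡ App m₁ m₂ → Path lab n (τ ∷ʳ ↘) m₂

data Child {N : ℕ} (lab : Fin N → Label N) : Fin N → Fin N → Set where
  cAbs : ∀ {k m} → lab k ≡ Abs m → Child lab k m
  cL   : ∀ {k m₁ m₂} → lab k ≡ App m₁ m₂ → Child lab k m₁
  cR   : ∀ {k m₁ m₂} → lab k ≡ App m₁ m₂ → Child lab k m₂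

Root : {N : ℕ} → (Fin N → Label N) → Fin N → Set
Root lab r = ∀ k → ¬ Child lab k r

record LambdaGraph : Set where
  field
    N       : ℕ
    label   : Fin N → Label N
    bindAbs : ∀ v b → label v ≡ BVar b → Σ (Fin N) (λ m → label b ≡ Abs m)
    acyclic : ∀ n d τ → ¬ Path label n (d ∷ τ) n
    dominated : ∀ v b → label v ≡ BVar b → ∀ r τ → Root label r → Path label r τ v →
                Σ Trace (λ τ₁ → Σ Trace (λ τ₂ →
                  (τ ≡ τ₁ ++ τ₂) × Path label r τ₁ b × Path label b τ₂ v))

data Prop {N : ℕ} (lab : Fin N → Label N) (R : Rel (Fin N) 0ℓ) : Rel (Fin N) 0ℓ where
  base : ∀ {n m} → R n m → Prop lab R n m
  appL : ∀ {a b n₁ n₂ m₁ m₂} → Prop lab R a b → lab a ≡ App n₁ n₂ → lab b ≡ App m₁ m₂ →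
         Prop lab R n₁ m₁
  appR : ∀ {a b n₁ n₂ m₁ m₂} → Prop lab R a b → lab a ≡ App n₁ n₂ → lab b ≡ App m₁ m₂ →
         Prop lab R n₂ m₂
  abs  : ∀ {a b n m} → Prop lab R a b → lab a ≡ Abs n → lab b ≡ Abs m → Prop lab R n m

module Submission where

-- Both directions are inductions, and neither uses the λ-graph axioms
-- (acyclicity, binders, domination): the equivalence holds for every
-- labelling  lab : Fin N → Label N, and is proved in that generality.
--  * (⇒) `propagation⇒paths`: induction on the derivation of R⇓.  A base
--    pair is reached by ε; each closure rule App/App or Abs/Abs extends
--    both witnessing paths by the same direction.
--  * (⇐) `paths⇒propagation`: induction on the path  n′ →τ n.  Paths are
--    built by appending a direction to a shorter path, so we first invert
--    the second path  m′ →τ m : for τ = [] it is trivial (`path-[]`), and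
--    for τ = σ ∷ʳ d it splits as  m′ →σ k  followed by one d-step out of k
--    (`path-∷ʳ`).  The last steps of the two paths then form an App/App or
--    Abs/Abs pair, so the matching closure rule of R⇓ applies.

open import Defs
open import Data.Nat using (ℕ)
open import Data.Fin using (Fin)
open import Data.List using ([]; _∷_; _∷ʳ_)
open import Data.List.Properties using (∷ʳ-injective)
open import Data.Product using (Σ; _×_; _,_)
open import Data.Empty using (⊥-elim)
open import Relation.Nullary using (¬_)
open import Relation.Binary.Core using (Rel)
open import Relation.Binary.PropositionalEquality using (_≡_; refl; sym; subst)
open import Function.Bundles using (_⇔_; mk⇔)
open import Level using (0ℓ)

[]≢∷ʳ : ∀ (τ : Trace) d → ¬ ([] ≡ τ ∷ʳ d)
[]≢∷ʳ []      d ()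
[]≢∷ʳ (_ ∷ _) d ()

module _ {N : ℕ} (lab : Fin N → Label N) where

  data Step : Fin N → Dir → Fin N → Set where
    step↓ : ∀ {k m}     → lab k ≡ Abs m     → Step k ↓ m
    step↙ : ∀ {k m₁ m₂} → lab k ≡ App m₁ m₂ → Step k ↙ m₁
    step↘ : ∀ {k m₁ m₂} → lab k ≡ App m₁ m₂ → Step k ↘ m₂

  -- Inversion of a path along the empty trace: it is the trivial path.
  -- (The trace is kept as an index equation so the lemma applies to an
  -- arbitrary path value.)
  path-[] : ∀ {a σ b} → Path lab a σ b → σ ≡ [] → a ≡ b
  path-[] ε                   _  = refl
  path-[] (dn  {τ = τ} _ _) e = ⊥-elim ([]≢∷ʳ τ ↓ (sym e))
  path-[] (lft {τ = τ} _ _) e = ⊥-elim ([]≢∷ʳ τ ↙ (sym e))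
  path-[] (rgt {τ = τ} _ _) e = ⊥-elim ([]≢∷ʳ τ ↘ (sym e))

  path-∷ʳ : ∀ {a σ b} τ d → Path lab a σ b → σ ≡ τ ∷ʳ d →
            Σ (Fin N) (λ k → Path lab a τ k × Step k d b)
  path-∷ʳ τ d ε e = ⊥-elim ([]≢∷ʳ τ d e)
  path-∷ʳ τ d (dn {τ = τ′} p x) e with ∷ʳ-injective τ′ τ e
  ... | refl , refl = _ , p , step↓ x
  path-∷ʳ τ d (lft {τ = τ′} p x) e with ∷ʳ-injective τ′ τ e
  ... | refl , refl = _ , p , step↙ x
  path-∷ʳ τ d (rgt {τ = τ′} p x) e with ∷ʳ-injective τ′ τ e
  ... | refl , refl = _ , p , step↘ x

  module _ (R : Rel (Fin N) 0ℓ) where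

    CoReachable : Fin N → Fin N → Set
    CoReachable n m = Σ Trace (λ τ → Σ (Fin N) (λ n′ → Σ (Fin N) (λ m′ →
      R n′ m′ × Path lab n′ τ n × Path lab m′ τ m)))

    propagation⇒paths : ∀ {n m} → Prop lab R n m → CoReachable n m
    propagation⇒paths (base r) = [] , _ , _ , r , ε , ε
    propagation⇒paths (appL p x y) with propagation⇒paths p
    ... | τ , _ , _ , r , pₙ , pₘ = τ ∷ʳ ↙ , _ , _ , r , lft pₙ x , lft pₘ y
    propagation⇒paths (appR p x y) with propagation⇒paths p
    ... | τ , _ , _ , r , pₙ , pₘ = τ ∷ʳ ↘ , _ , _ , r , rgt pₙ x , rgt pₘ y
    propagation⇒paths (abs p x y) with propagation⇒paths p
    ... | τ , _ , _ , r , pₙ , pₘ = τ ∷ʳ ↓ , _ , _ , r , dn pₙ x , dn pₘ y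

    paths⇒propagation : ∀ {n m n′ m′ τ} → R n′ m′ →
                        Path lab n′ τ n → Path lab m′ τ m → Prop lab R n m
    paths⇒propagation r ε pₘ = subst (Prop lab R _) (path-[] pₘ refl) (base r)
    paths⇒propagation r (dn {τ = τ} pₙ x) pₘ with path-∷ʳ τ ↓ pₘ refl
    ... | _ , pₘ′ , step↓ y = abs (paths⇒propagation r pₙ pₘ′) x y
    paths⇒propagation r (lft {τ = τ} pₙ x) pₘ with path-∷ʳ τ ↙ pₘ refl
    ... | _ , pₘ′ , step↙ y = appL (paths⇒propagation r pₙ pₘ′) x y
    paths⇒propagation r (rgt {τ = τ} pₙ x) pₘ with path-∷ʳ τ ↘ pₘ refl
    ... | _ , pₘ′ , step↘ y = appR (paths⇒propagation r pₙ pₘ′) x y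

    propagation⇔paths : ∀ n m → Prop lab R n m ⇔ CoReachable n m
    propagation⇔paths n m = mk⇔ propagation⇒paths
      (λ { (_ , _ , _ , r , pₙ , pₘ) → paths⇒propagation r pₙ pₘ })

mainTheorem7 : (G : LambdaGraph) → let open LambdaGraph G in
    (R : Rel (Fin N) 0ℓ) → (n m : Fin N) →
    Prop label R n m ⇔
      Σ Trace (λ τ → Σ (Fin N) (λ n′ → Σ (Fin N) (λ m′ →
        R n′ m′ × Path label n′ τ n × Path label m′ τ m)))
mainTheorem7 G = propagation⇔paths (LambdaGraph.label G)
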